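{- Let $q=p^n$ with $p$ prime and let $f\in\mathbb{F}_q[x]$ be a polynomial of degree $k$ for some $0<k<q$. If $|D_f^{ -1}D_f|<q-k+2$, then $f$ is a permutation of $\mathbb{F}_q$.
   Context: For $f\in\mathbb{F}_q[x]$ (viewed as a function $\mathbb{F}_q\to\mathbb{F}_q$), $D_f=\{(f(x)-f(y))/(x-y) : x,y\in\mathbb{F}_q,\ x\neq y\}$ is the set of directions determined by $f$. For $A,B\subseteq\mathbb{F}_q$: $A^{ -1}=\{a^{ -1} : a\in A\setminus\{0\}\}$ and $AB=\{ab : a\in A,\ b\in B\}$. -}

module Defs where

open import Level using (0ℓ)
open import Data.Nat as ℕ using (ℕ; zero; suc)
open import Data.Fin using (Fin; fromℕ; toℕ)
open import Data.List using (List; length)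
open import Data.List.Membership.Propositional using (_∈_)
open import Data.List.Relation.Unary.Unique.Propositional using (Unique)
open import Data.Product using (Σ; ∃; ∃-syntax; _×_; _,_)
open import Relation.Binary.PropositionalEquality using (_≡_; _≢_)
open import Relation.Binary.Definitions using (DecidableEquality)
open import Algebra.Structures using (IsCommutativeRing)
open import Function.Bundles using (_↔_)

record FiniteField : Set₁ where
  infixl 6 _+_ _-_
  infixl 7 _*_
  field
    Carrier : Set
    _+_ _*_ : Carrier → Carrier → Carrier
    -_      : Carrier → Carrier
    0# 1#   : Carrier
    isCommutativeRing : IsCommutativeRing _≡_ _+_ _*_ -_ 0# 1#
    0≢1     : 0# ≢ 1#
    inverse : ∀ x → x ≢ 0# → ∃[ y ] (x * y ≡ 1#)
    size    : ℕ
    enum    : Fin size ↔ Carrier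

  _-_ : Carrier → Carrier → Carrier
  x - y = x + (- y)

module _ (F : FiniteField) where
  open FiniteField F

  Subset : Set₁
  Subset = Carrier → Set

  pow : Carrier → ℕ → Carrier
  pow x zero    = 1#
  pow x (suc n) = x * pow x n

  -- Σ_{i ≤ k} a i * x ^ i   (a polynomial with coefficients a 0 , … , a k)
  evalPoly : (k : ℕ) → (Fin (suc k) → Carrier) → Carrier → Carrier
  evalPoly zero    a x = a Fin.zero
  evalPoly (suc k) a x = a Fin.zero + x * evalPoly k (λ i → a (Fin.suc i)) x

  Directions : (Carrier → Carrier) → Subset
  Directions f d = ∃[ x ] ∃[ y ] (x ≢ y × ∃[ w ] ((x - y) * w ≡ 1# × d ≡ (f x - f y) * w))

  Inv : Subset → Subset
  Inv A z = ∃[ a ] (A a × a ≢ 0# × a * z ≡ 1#)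

  Prod : Subset → Subset → Subset
  Prod A B z = ∃[ a ] ∃[ b ] (A a × B b × z ≡ a * b)

  HasCard : Subset → ℕ → Set
  HasCard A c = ∃[ xs ] (Unique xs × length xs ≡ c × (∀ x → (x ∈ xs → A x) × (A x → x ∈ xs)))

{-# OPTIONS --safe #-}
module Submission where

-- Suppose f x₀ = f y₀ with x₀ ≠ y₀.  For every y off the fibre f⁻¹(f y₀) the slopes
-- d₁ = (f y - f x₀)/(y - x₀) and d₂ = (f y - f y₀)/(y - y₀) lie in D_f, d₁ ≠ 0, and
-- d₁⁻¹ d₂ = (y - x₀)/(y - y₀) = 1 + (y₀ - x₀)/(y - y₀), which determines y and is
-- neither 0 nor 1.  A polynomial of degree k takes each value at most k times, so
-- there are at least q - k such y; together with 0 = d₁⁻¹ · slope(x₀, y₀) and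
-- 1 = d₁⁻¹ d₁ this gives |D_f⁻¹ D_f| ≥ q - k + 2.  Hence f is injective, and an
-- injective self-map of a finite set is a permutation.

open import Defs
open import Data.Nat as ℕ using (ℕ; zero; suc; _≤_; _<_; z≤n; s≤s)
open import Data.Nat.Properties using (≤-trans; ≤-reflexive; +-monoˡ-≤; +-monoʳ-≤; +-suc; <⇒≱; module ≤-Reasoning)
import Data.Nat.Properties as ℕₚ
open import Data.Nat.Primality using (Prime)
open import Data.Fin using (Fin; fromℕ)
open import Data.Fin.Properties using (injective⇒≤) renaming (_≟_ to _≟ᶠ_)
open import Data.Vec.Functional using (tail)
open import Data.List using (List; []; _∷_; length; map; allFin; filter; lookup)
open import Data.List.Properties using (length-map; length-tabulate)
open import Data.List.Membership.Propositional using (_∈_)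
open import Data.List.Membership.Propositional.Properties using (∈-map⁺; ∈-map⁻; ∈-allFin; ∈-filter⁻; ∈-lookup)
open import Data.List.Membership.Setoid.Properties using (index-injective)
import Data.List.Membership.DecPropositional
open import Data.List.Relation.Binary.Subset.Propositional using (_⊆_)
open import Data.List.Relation.Unary.All as All using (All; []; _∷_; all?)
open import Data.List.Relation.Unary.All.Properties as All using (¬All⇒Any¬)
open import Data.List.Relation.Unary.Any using (index; satisfied)
open import Data.List.Relation.Unary.AllPairs using (_∷_)
open import Data.List.Relation.Unary.Unique.Propositional using (Unique)
import Data.List.Relation.Unary.Unique.Propositional.Properties as Unique
open import Data.Product using (∃; ∃-syntax; _×_; _,_; proj₁; proj₂)
open import Relation.Nullary using (yes; no; does; contradiction)
open import Relation.Unary using (Pred; Decidable)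
open import Relation.Unary.Properties using (∁?)
open import Data.Bool using (true; false)
open import Relation.Nullary.Decidable using (via-injection)
open import Relation.Binary.Definitions using (DecidableEquality)
open import Relation.Binary.PropositionalEquality using (_≡_; _≢_; ≢-sym; refl; sym; trans; cong; subst; setoid; module ≡-Reasoning)
open import Function.Bundles using (Inverse; Injection)
open import Function.Definitions using (Injective; Surjective; Bijective)
open import Function.Properties.Inverse using (↔⇒↣; ↔-sym)
open import Algebra.Bundles using (CommutativeRing)
import Algebra.Properties.Ring as RingProperties
import Algebra.Solver.Ring.NaturalCoefficients.Default as SemiringSolver

module _ {a} {A : Set a} where

  Unique⇒lookup-injective : ∀ {xs : List A} → Unique xs → Injective _≡_ _≡_ (lookup xs)
  Unique⇒lookup-injective {_ ∷ _}  _             {Fin.zero}  {Fin.zero}  _ = refl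
  Unique⇒lookup-injective {_ ∷ _}  (x∉xs ∷ _)    {Fin.zero}  {Fin.suc j} e = contradiction e (All.lookup x∉xs (∈-lookup j))
  Unique⇒lookup-injective {_ ∷ _}  (x∉xs ∷ _)    {Fin.suc i} {Fin.zero}  e = contradiction (sym e) (All.lookup x∉xs (∈-lookup i))
  Unique⇒lookup-injective {_ ∷ _}  (_ ∷ unique)  {Fin.suc i} {Fin.suc j} e = cong Fin.suc (Unique⇒lookup-injective unique e)

  Unique-⊆⇒length≤ : ∀ {xs ys : List A} → Unique xs → xs ⊆ ys → length xs ≤ length ys
  Unique-⊆⇒length≤ {xs} {ys} unique xs⊆ys = injective⇒≤ {f = position} position-injective
    where
    position : Fin (length xs) → Fin (length ys)
    position i = index (xs⊆ys (∈-lookup i))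
    position-injective : Injective _≡_ _≡_ position
    position-injective {i} {j} e = Unique⇒lookup-injective unique
      (index-injective (setoid A) (xs⊆ys (∈-lookup i)) (xs⊆ys (∈-lookup j)) e)

  length-filter+length-filter-∁ : ∀ {p} {P : Pred A p} (P? : Decidable P) xs →
                                  length (filter P? xs) ℕ.+ length (filter (∁? P?) xs) ≡ length xs
  length-filter+length-filter-∁ P? []       = refl
  length-filter+length-filter-∁ P? (x ∷ xs) with does (P? x)
  ... | true  = cong suc (length-filter+length-filter-∁ P? xs)
  ... | false = trans (+-suc _ _) (cong suc (length-filter+length-filter-∁ P? xs))

module _ (F : FiniteField) where
  open FiniteField F

  commutativeRing : CommutativeRing _ _
  commutativeRing = record { isCommutativeRing = isCommutativeRing }

  open CommutativeRing commutativeRing using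
    ( +-assoc; +-identityˡ; -‿inverseˡ; -‿inverseʳ
    ; *-comm; *-assoc; *-identityˡ; distribʳ; zeroˡ; zeroʳ
    ; ring; commutativeSemiring )
  open RingProperties ring using (+-cancelˡ; +-cancelʳ; +-identityʳ-unique; x∙y⁻¹≈ε⇒x≈y)
  open SemiringSolver commutativeSemiring using (solve; _:=_; _:+_; _:*_)

  _≟_ : DecidableEquality Carrier
  _≟_ = via-injection (↔⇒↣ (↔-sym enum)) _≟ᶠ_

  open Data.List.Membership.DecPropositional _≟_ using (_∈?_)

  elements : List Carrier
  elements = map (Inverse.to enum) (allFin size)

  length-elements : length elements ≡ size
  length-elements = trans (length-map _ (allFin size)) (length-tabulate _)

  ∈-elements : ∀ x → x ∈ elements
  ∈-elements x = subst (_∈ elements) (Inverse.strictlyInverseˡ enum x) (∈-map⁺ _ (∈-allFin _))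

  elements-unique : Unique elements
  elements-unique = Unique.map⁺ (Injection.injective (↔⇒↣ enum)) (Unique.allFin⁺ size)

  Unique⇒length≤size : ∀ {xs} → Unique xs → length xs ≤ size
  Unique⇒length≤size unique = ≤-trans (Unique-⊆⇒length≤ unique (λ {x} _ → ∈-elements x)) (≤-reflexive length-elements)

  HasCard⇒length≤ : ∀ {A c xs} → HasCard F A c → Unique xs → All A xs → length xs ≤ c
  HasCard⇒length≤ {xs = xs} (_ , _ , length-ys , ys-lists-A) unique xs⊆A =
    subst (length xs ≤_) length-ys (Unique-⊆⇒length≤ unique (λ x∈xs → proj₂ (ys-lists-A _) (All.lookup xs⊆A x∈xs)))

  injective⇒surjective : ∀ {g : Carrier → Carrier} → Injective _≡_ _≡_ g → Surjective _≡_ _≡_ g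
  injective⇒surjective {g} g-injective y with y ∈? map g elements
  ... | yes y∈image with x , _ , y≡gx ← ∈-map⁻ g y∈image = x , λ { refl → sym y≡gx }
  ... | no y∉image = contradiction (Unique⇒length≤size unique) (<⇒≱ (s≤s (≤-reflexive (sym size≡))))
    where
    unique : Unique (y ∷ map g elements)
    unique = All.tabulate (λ y′∈image y≡y′ → y∉image (subst (_∈ _) (sym y≡y′) y′∈image))
           ∷ Unique.map⁺ g-injective elements-unique
    size≡ : length (map g elements) ≡ size
    size≡ = trans (length-map g elements) length-elements

  infix 8 _⁻¹
  infixl 7 _/_

  -- Total inverse with the junk value 0⁻¹ = 0; this makes ⁻¹ an involution of the whole field.
  _⁻¹ : Carrier → Carrier
  x ⁻¹ with x ≟ 0#
  ... | yes _   = 0#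
  ... | no  x≢0 = proj₁ (inverse x x≢0)

  _/_ : Carrier → Carrier → Carrier
  x / y = x * y ⁻¹

  0⁻¹≡0 : 0# ⁻¹ ≡ 0#
  0⁻¹≡0 with 0# ≟ 0#
  ... | yes _   = refl
  ... | no  0≢0 = contradiction refl 0≢0

  ⁻¹-inverseʳ : ∀ {x} → x ≢ 0# → x * x ⁻¹ ≡ 1#
  ⁻¹-inverseʳ {x} x≢0 with x ≟ 0#
  ... | yes x≡0 = contradiction x≡0 x≢0
  ... | no  x≢0 = proj₂ (inverse x x≢0)

  ⁻¹-inverseˡ : ∀ {x} → x ≢ 0# → x ⁻¹ * x ≡ 1#
  ⁻¹-inverseˡ {x} x≢0 = trans (*-comm _ x) (⁻¹-inverseʳ x≢0)

  x*y≡1⇒x≢0 : ∀ {x y} → x * y ≡ 1# → x ≢ 0#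
  x*y≡1⇒x≢0 {y = y} xy≡1 refl = 0≢1 (trans (sym (zeroˡ y)) xy≡1)

  *-cancelˡ : ∀ {x y z} → x ≢ 0# → x * y ≡ x * z → y ≡ z
  *-cancelˡ {x} {y} {z} x≢0 xy≡xz = begin
    y              ≡⟨ sym (*-identityˡ y) ⟩
    1# * y         ≡⟨ cong (_* y) (sym (⁻¹-inverseˡ x≢0)) ⟩
    x ⁻¹ * x * y   ≡⟨ *-assoc _ x y ⟩
    x ⁻¹ * (x * y) ≡⟨ cong (x ⁻¹ *_) xy≡xz ⟩
    x ⁻¹ * (x * z) ≡⟨ sym (*-assoc _ x z) ⟩
    x ⁻¹ * x * z   ≡⟨ cong (_* z) (⁻¹-inverseˡ x≢0) ⟩
    1# * z         ≡⟨ *-identityˡ z ⟩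
    z              ∎
    where open ≡-Reasoning

  x*z≡y*z⇒z≡0 : ∀ {x y z} → x ≢ y → x * z ≡ y * z → z ≡ 0#
  x*z≡y*z⇒z≡0 {x} {y} {z} x≢y xz≡yz with z ≟ 0#
  ... | yes z≡0 = z≡0
  ... | no  z≢0 = contradiction (*-cancelˡ z≢0 (trans (*-comm z x) (trans xz≡yz (*-comm y z)))) x≢y

  *-≢0 : ∀ {x y} → x ≢ 0# → y ≢ 0# → x * y ≢ 0#
  *-≢0 {x} x≢0 y≢0 xy≡0 = y≢0 (*-cancelˡ x≢0 (trans xy≡0 (sym (zeroʳ x))))

  ⁻¹-unique : ∀ {x y} → x * y ≡ 1# → y ≡ x ⁻¹
  ⁻¹-unique {x} xy≡1 = *-cancelˡ x≢0 (trans xy≡1 (sym (⁻¹-inverseʳ x≢0)))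
    where
    x≢0 : x ≢ 0#
    x≢0 = x*y≡1⇒x≢0 xy≡1

  ⁻¹-involutive : ∀ x → x ⁻¹ ⁻¹ ≡ x
  ⁻¹-involutive x with x ≟ 0#
  ... | yes refl = 0⁻¹≡0
  ... | no  x≢0 = sym (⁻¹-unique (trans (*-comm _ x) (proj₂ (inverse x x≢0))))

  ⁻¹-injective : Injective _≡_ _≡_ _⁻¹
  ⁻¹-injective {x} {y} x⁻¹≡y⁻¹ = trans (sym (⁻¹-involutive x)) (trans (cong _⁻¹ x⁻¹≡y⁻¹) (⁻¹-involutive y))

  ⁻¹-≢0 : ∀ {x} → x ≢ 0# → x ⁻¹ ≢ 0#
  ⁻¹-≢0 {x} x≢0 x⁻¹≡0 = x≢0 (trans (sym (⁻¹-involutive x)) (trans (cong _⁻¹ x⁻¹≡0) 0⁻¹≡0))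

  [v/u]*[u*w]≡v*w : ∀ {u} v w → u ≢ 0# → v / u * (u * w) ≡ v * w
  [v/u]*[u*w]≡v*w {u} v w u≢0 = begin
    v * u ⁻¹ * (u * w)   ≡⟨ solve 4 (λ v p u w → v :* p :* (u :* w) := v :* (p :* u :* w)) refl v (u ⁻¹) u w ⟩
    v * (u ⁻¹ * u * w)   ≡⟨ cong (λ t → v * (t * w)) (⁻¹-inverseˡ u≢0) ⟩
    v * (1# * w)         ≡⟨ cong (v *_) (*-identityˡ w) ⟩
    v * w                ∎
    where open ≡-Reasoning

  [u/v]⁻¹*[u/w]≡v/w : ∀ {u v} w → u ≢ 0# → v ≢ 0# → (u / v) ⁻¹ * (u / w) ≡ v / w
  [u/v]⁻¹*[u/w]≡v/w {u} {v} w u≢0 v≢0 = begin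
    (u / v) ⁻¹ * (u / w) ≡⟨ cong (_* (u / w)) (sym (⁻¹-unique [u/v]*[v/u]≡1)) ⟩
    v / u * (u / w)      ≡⟨ [v/u]*[u*w]≡v*w v (w ⁻¹) u≢0 ⟩
    v / w                ∎
    where
    open ≡-Reasoning
    [u/v]*[v/u]≡1 : u / v * (v / u) ≡ 1#
    [u/v]*[v/u]≡1 = trans ([v/u]*[u*w]≡v*w u (u ⁻¹) v≢0) (⁻¹-inverseʳ u≢0)

  x≢y⇒x-y≢0 : ∀ {x y} → x ≢ y → x - y ≢ 0#
  x≢y⇒x-y≢0 x≢y x-y≡0 = x≢y (x∙y⁻¹≈ε⇒x≈y _ _ x-y≡0)

  [x-z]+[z-y]≡x-y : ∀ x y z → (x - z) + (z - y) ≡ x - y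
  [x-z]+[z-y]≡x-y x y z = begin
    x + - z + (z + - y)   ≡⟨ +-assoc x (- z) (z + - y) ⟩
    x + (- z + (z + - y)) ≡⟨ cong (x +_) (sym (+-assoc (- z) z (- y))) ⟩
    x + (- z + z + - y)   ≡⟨ cong (λ t → x + (t + - y)) (-‿inverseˡ z) ⟩
    x + (0# + - y)        ≡⟨ cong (x +_) (+-identityˡ (- y)) ⟩
    x + - y               ∎
    where open ≡-Reasoning

  [y-x]/[y-z]≡1+[z-x]/[y-z] : ∀ {x y z} → y ≢ z → (y - x) / (y - z) ≡ 1# + (z - x) / (y - z)
  [y-x]/[y-z]≡1+[z-x]/[y-z] {x} {y} {z} y≢z = begin
    (y - x) / (y - z)                     ≡⟨ cong (_/ (y - z)) (sym ([x-z]+[z-y]≡x-y y x z)) ⟩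
    ((y - z) + (z - x)) / (y - z)         ≡⟨ distribʳ ((y - z) ⁻¹) (y - z) (z - x) ⟩
    (y - z) / (y - z) + (z - x) / (y - z) ≡⟨ cong (_+ (z - x) / (y - z)) (⁻¹-inverseʳ (x≢y⇒x-y≢0 y≢z)) ⟩
    1# + (z - x) / (y - z)                ∎
    where open ≡-Reasoning

  -- Synthetic division: if p = a₀ + x p̃ then p / (x - r) = p̃(r) + x (p̃ / (x - r)).
  quotient : ∀ k → (Fin (suc (suc k)) → Carrier) → Carrier → Fin (suc k) → Carrier
  quotient k       a r Fin.zero    = evalPoly F k (tail a) r
  quotient (suc k) a r (Fin.suc i) = quotient k (tail a) r i

  quotient-last : ∀ k a r → quotient k a r (fromℕ k) ≡ a (fromℕ (suc k))
  quotient-last zero    a r = refl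
  quotient-last (suc k) a r = quotient-last k (tail a) r

  -- p(x) = p(r) + (x - r) q(x), with the subtraction moved across so that the semiring solver applies.
  evalPoly-quotient : ∀ k a x r →
    evalPoly F (suc k) a x + r * evalPoly F k (quotient k a r) x ≡ evalPoly F (suc k) a r + x * evalPoly F k (quotient k a r) x
  evalPoly-quotient zero a x r =
    solve 4 (λ a₀ a₁ x r → a₀ :+ x :* a₁ :+ r :* a₁ := a₀ :+ r :* a₁ :+ x :* a₁) refl (a Fin.zero) (a (Fin.suc Fin.zero)) x r
  evalPoly-quotient (suc k) a x r = begin
    a₀ + x * p x + r * (p r + x * q x) ≡⟨ solve 6 (λ a₀ x r px pr qx → a₀ :+ x :* px :+ r :* (pr :+ x :* qx)
                                                                    := a₀ :+ r :* pr :+ x :* (px :+ r :* qx))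
                                                   refl a₀ x r (p x) (p r) (q x) ⟩
    a₀ + r * p r + x * (p x + r * q x) ≡⟨ cong (λ t → a₀ + r * p r + x * t) (evalPoly-quotient k (tail a) x r) ⟩
    a₀ + r * p r + x * (p r + x * q x) ∎
    where
    open ≡-Reasoning
    a₀ : Carrier
    a₀ = a Fin.zero
    p q : Carrier → Carrier
    p = evalPoly F (suc k) (tail a)
    q = evalPoly F k (quotient k (tail a) r)

  quotient-root : ∀ k a {r y} → evalPoly F (suc k) a y ≡ evalPoly F (suc k) a r → r ≢ y →
                  evalPoly F k (quotient k a r) y ≡ 0#
  quotient-root k a {r} {y} py≡pr r≢y =
    x*z≡y*z⇒z≡0 r≢y (+-cancelˡ (evalPoly F (suc k) a r) _ _ (trans (cong (_+ r * q) (sym py≡pr)) (evalPoly-quotient k a y r)))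
    where
    q : Carrier
    q = evalPoly F k (quotient k a r) y

  roots≤degree : ∀ k a → a (fromℕ k) ≢ 0# → ∀ {ys} → Unique ys → All (λ y → evalPoly F k a y ≡ 0#) ys → length ys ≤ k
  fibre≤degree : ∀ k a {c} → a (fromℕ (suc k)) ≢ 0# → ∀ {ys} → Unique ys → All (λ y → evalPoly F (suc k) a y ≡ c) ys →
                 length ys ≤ suc k

  roots≤degree zero    a a₀≢0   {[]}    _ _          = z≤n
  roots≤degree zero    a a₀≢0   {_ ∷ _} _ (a₀≡0 ∷ _) = contradiction a₀≡0 a₀≢0
  roots≤degree (suc k) a lead≢0 = fibre≤degree k a lead≢0

  fibre≤degree k a lead≢0 {[]}     _                _                = z≤n
  fibre≤degree k a lead≢0 {r ∷ ys} (r∉ys ∷ unique) (pr≡c ∷ pys≡c) =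
    s≤s (roots≤degree k (quotient k a r) (subst (_≢ 0#) (sym (quotient-last k a r)) lead≢0) unique
          (All.zipWith (λ (r≢y , py≡c) → quotient-root k a (trans py≡c (sym pr≡c)) r≢y) (r∉ys , pys≡c)))

  slope : (Carrier → Carrier) → Carrier → Carrier → Carrier
  slope f x y = (f x - f y) / (x - y)

  slope∈Directions : ∀ f {x y} → x ≢ y → Directions F f (slope f x y)
  slope∈Directions f {x} {y} x≢y = x , y , x≢y , (x - y) ⁻¹ , ⁻¹-inverseʳ (x≢y⇒x-y≢0 x≢y) , refl

  slope≢0 : ∀ f {x y} → f x ≢ f y → slope f x y ≢ 0#
  slope≢0 f fx≢fy = *-≢0 (x≢y⇒x-y≢0 fx≢fy) (⁻¹-≢0 (x≢y⇒x-y≢0 (λ x≡y → fx≢fy (cong f x≡y))))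

  slope≡0 : ∀ f {x y} → f x ≡ f y → slope f x y ≡ 0#
  slope≡0 f {x} {y} fx≡fy = begin
    (f x - f y) / (x - y) ≡⟨ cong (λ t → (t - f y) / (x - y)) fx≡fy ⟩
    (f y - f y) / (x - y) ≡⟨ cong (_/ (x - y)) (-‿inverseʳ (f y)) ⟩
    0# / (x - y)          ≡⟨ zeroˡ _ ⟩
    0#                    ∎
    where open ≡-Reasoning

  Ratios : Subset F → Subset F
  Ratios A = Prod F (Inv F A) A

  ratio∈Ratios : ∀ {A a b} → A a → a ≢ 0# → A b → Ratios A (a ⁻¹ * b)
  ratio∈Ratios {a = a} Aa a≢0 Ab = a ⁻¹ , _ , (a , Aa , a≢0 , ⁻¹-inverseʳ a≢0) , Ab , refl

  module Collision {k} (a : Fin (suc (suc k)) → Carrier) (lead≢0 : a (fromℕ (suc k)) ≢ 0#)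
                   {x₀ y₀} (x₀≢y₀ : x₀ ≢ y₀) (fx₀≡fy₀ : evalPoly F (suc k) a x₀ ≡ evalPoly F (suc k) a y₀) where

    f : Carrier → Carrier
    f = evalPoly F (suc k) a

    inFibre? : Decidable (λ y → f y ≡ f y₀)
    inFibre? y = f y ≟ f y₀

    offFibre : List Carrier
    offFibre = filter (∁? inFibre?) elements

    offFibre-unique : Unique offFibre
    offFibre-unique = Unique.filter⁺ (∁? inFibre?) elements-unique

    offFibre-off : All (λ y → f y ≢ f y₀) offFibre
    offFibre-off = All.tabulate (λ y∈ → proj₂ (∈-filter⁻ (∁? inFibre?) {xs = elements} y∈))

    size≤degree+|offFibre| : size ≤ suc k ℕ.+ length offFibre
    size≤degree+|offFibre| =
      subst (_≤ suc k ℕ.+ length offFibre) (trans (length-filter+length-filter-∁ inFibre? elements) length-elements)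
        (+-monoˡ-≤ (length offFibre) fibre≤degree+1)
      where
      fibre : List Carrier
      fibre = filter inFibre? elements
      fibre≤degree+1 : length fibre ≤ suc k
      fibre≤degree+1 = fibre≤degree k a lead≢0 (Unique.filter⁺ inFibre? elements-unique)
                         (All.tabulate (λ y∈ → proj₂ (∈-filter⁻ inFibre? {xs = elements} y∈)))

    ∃-off-fibre : suc k < size → ∃ λ w → f w ≢ f y₀
    ∃-off-fibre k<size with all? inFibre? elements
    ... | yes all-in = contradiction (≤-trans (≤-reflexive (sym length-elements)) (fibre≤degree k a lead≢0 elements-unique all-in))
                                     (<⇒≱ k<size)
    ... | no ¬all-in = satisfied (¬All⇒Any¬ inFibre? elements ¬all-in)

    δ : Carrier
    δ = y₀ - x₀

    δ≢0 : δ ≢ 0#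
    δ≢0 = x≢y⇒x-y≢0 (≢-sym x₀≢y₀)

    slopeRatio : Carrier → Carrier
    slopeRatio y = 1# + δ / (y - y₀)

    slopeRatio-injective : Injective _≡_ _≡_ slopeRatio
    slopeRatio-injective {y} {z} e =
      +-cancelʳ (- y₀) y z (⁻¹-injective (*-cancelˡ δ≢0 (+-cancelˡ 1# _ _ e)))

    slopeRatio≢1 : ∀ {y} → y ≢ y₀ → slopeRatio y ≢ 1#
    slopeRatio≢1 y≢y₀ e = *-≢0 δ≢0 (⁻¹-≢0 (x≢y⇒x-y≢0 y≢y₀)) (+-identityʳ-unique 1# _ e)

    module OffFibre {y} (fy≢fy₀ : f y ≢ f y₀) where

      y≢y₀ : y ≢ y₀
      y≢y₀ y≡y₀ = fy≢fy₀ (cong f y≡y₀)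

      fy≢fx₀ : f y ≢ f x₀
      fy≢fx₀ fy≡fx₀ = fy≢fy₀ (trans fy≡fx₀ fx₀≡fy₀)

      y≢x₀ : y ≢ x₀
      y≢x₀ y≡x₀ = fy≢fx₀ (cong f y≡x₀)

      slopeRatio≡ : (slope f y x₀) ⁻¹ * slope f y y₀ ≡ slopeRatio y
      slopeRatio≡ = begin
        ((f y - f x₀) / (y - x₀)) ⁻¹ * ((f y - f y₀) / (y - y₀))
          ≡⟨ cong (λ t → ((f y - t) / (y - x₀)) ⁻¹ * ((f y - f y₀) / (y - y₀))) fx₀≡fy₀ ⟩
        ((f y - f y₀) / (y - x₀)) ⁻¹ * ((f y - f y₀) / (y - y₀))
          ≡⟨ [u/v]⁻¹*[u/w]≡v/w (y - y₀) (x≢y⇒x-y≢0 fy≢fy₀) (x≢y⇒x-y≢0 y≢x₀) ⟩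
        (y - x₀) / (y - y₀)
          ≡⟨ [y-x]/[y-z]≡1+[z-x]/[y-z] y≢y₀ ⟩
        slopeRatio y
          ∎
        where open ≡-Reasoning

      slopeRatio∈Ratios : Ratios (Directions F f) (slopeRatio y)
      slopeRatio∈Ratios = subst (Ratios (Directions F f)) slopeRatio≡
        (ratio∈Ratios (slope∈Directions f y≢x₀) (slope≢0 f fy≢fx₀) (slope∈Directions f y≢y₀))

      slopeRatio≢0 : slopeRatio y ≢ 0#
      slopeRatio≢0 e = *-≢0 (x≢y⇒x-y≢0 y≢x₀) (⁻¹-≢0 (x≢y⇒x-y≢0 y≢y₀))
                           (trans ([y-x]/[y-z]≡1+[z-x]/[y-z] y≢y₀) e)

    2+|offFibre|≤card : suc k < size → ∀ {c} → HasCard F (Ratios (Directions F f)) c → 2 ℕ.+ length offFibre ≤ c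
    2+|offFibre|≤card k<size {c} card =
      subst (_≤ c) (cong (2 ℕ.+_) (length-map slopeRatio offFibre)) (HasCard⇒length≤ card unique all-ratios)
      where
      open OffFibre
      w : Carrier
      w = proj₁ (∃-off-fibre k<size)
      fw≢fy₀ : f w ≢ f y₀
      fw≢fy₀ = proj₂ (∃-off-fibre k<size)
      d : Carrier
      d = slope f w x₀
      d∈D : Directions F f d
      d∈D = slope∈Directions f (y≢x₀ fw≢fy₀)
      d≢0 : d ≢ 0#
      d≢0 = slope≢0 f (fy≢fx₀ fw≢fy₀)

      unique : Unique (0# ∷ 1# ∷ map slopeRatio offFibre)
      unique = (0≢1 ∷ All.map⁺ (All.map (λ off e → slopeRatio≢0 off (sym e)) offFibre-off))
             ∷ All.map⁺ (All.map (λ off e → slopeRatio≢1 (y≢y₀ off) (sym e)) offFibre-off)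
             ∷ Unique.map⁺ slopeRatio-injective offFibre-unique

      all-ratios : All (Ratios (Directions F f)) (0# ∷ 1# ∷ map slopeRatio offFibre)
      all-ratios = 0∈Ratios ∷ 1∈Ratios ∷ All.map⁺ (All.map slopeRatio∈Ratios offFibre-off)
        where
        0∈D : Directions F f 0#
        0∈D = subst (Directions F f) (slope≡0 f fx₀≡fy₀) (slope∈Directions f x₀≢y₀)
        0∈Ratios : Ratios (Directions F f) 0#
        0∈Ratios = subst (Ratios _) (zeroʳ (d ⁻¹)) (ratio∈Ratios d∈D d≢0 0∈D)
        1∈Ratios : Ratios (Directions F f) 1#
        1∈Ratios = subst (Ratios _) (⁻¹-inverseˡ d≢0) (ratio∈Ratios d∈D d≢0 d∈D)

    size+2≤degree+card : suc k < size → ∀ {c} → HasCard F (Ratios (Directions F f)) c → size ℕ.+ 2 ≤ suc k ℕ.+ c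
    size+2≤degree+card k<size {c} card = begin
      size ℕ.+ 2                            ≤⟨ +-monoˡ-≤ 2 size≤degree+|offFibre| ⟩
      suc k ℕ.+ length offFibre ℕ.+ 2       ≡⟨ ℕₚ.+-assoc (suc k) (length offFibre) 2 ⟩
      suc k ℕ.+ (length offFibre ℕ.+ 2)     ≡⟨ cong (suc k ℕ.+_) (ℕₚ.+-comm (length offFibre) 2) ⟩
      suc k ℕ.+ (2 ℕ.+ length offFibre)     ≤⟨ +-monoʳ-≤ (suc k) (2+|offFibre|≤card k<size card) ⟩
      suc k ℕ.+ c                           ∎
      where open ≤-Reasoning

  few-ratios⇒injective : ∀ {k} (a : Fin (suc (suc k)) → Carrier) → a (fromℕ (suc k)) ≢ 0# → suc k < size →
                         ∀ {c} → HasCard F (Ratios (Directions F (evalPoly F (suc k) a))) c → c ℕ.+ suc k < size ℕ.+ 2 →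
                         Injective _≡_ _≡_ (evalPoly F (suc k) a)
  few-ratios⇒injective {k} a lead≢0 k<size {c} card few {x} {y} fx≡fy with x ≟ y
  ... | yes x≡y = x≡y
  ... | no  x≢y = contradiction (Collision.size+2≤degree+card a lead≢0 x≢y fx≡fy k<size card)
                                (<⇒≱ (subst (_< size ℕ.+ 2) (ℕₚ.+-comm c (suc k)) few))

open import Data.Nat using (_+_; _^_)

theorem2 : (F : FiniteField) (p n : ℕ) → Prime p → FiniteField.size F ≡ p ^ n →
    (k : ℕ) → 0 < k → k < FiniteField.size F →
    (a : Fin (suc k) → FiniteField.Carrier F) → a (fromℕ k) ≢ FiniteField.0# F →
    (∃[ c ] (HasCard F (Prod F (Inv F (Directions F (evalPoly F k a))) (Directions F (evalPoly F k a))) c × c + k < FiniteField.size F + 2)) →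
    Bijective _≡_ _≡_ (evalPoly F k a)
theorem2 F _ _ _ _ (suc k) _ k<size a lead≢0 (_ , card , few) = injective , injective⇒surjective F injective
  where
  injective : Injective _≡_ _≡_ (evalPoly F (suc k) a)
  injective = few-ratios⇒injective F a lead≢0 k<size card few
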